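{- For each integer $n\geq 2$ there is a binary relation $\mathbf{C}_n=(C_{n- },C_{n+},C_n)$ with $|C_{n- }|=|C_{n+}|=n!$ such that $\delta(\mathbf{C}_n)=\delta(\mathbf{C}_n^\perp)=n$.
   Context: A binary relation is a triple $\mathbf{A}=(A_-,A_+,A)$ where $A_-,A_+$ are sets and $A\subseteq A_-\times A_+$. A subset $Y\subseteq A_+$ is $\mathbf{A}$-dominating if for every $a\in A_-$ there is $\alpha\in Y$ with $a\mathrel{A}\alpha$. The dominating number $\delta(\mathbf{A})$ is the minimum cardinality of an $\mathbf{A}$-dominating family, and $\delta(\mathbf{A})=\infty$ if no dominating family exists. The dual of $\mathbf{A}$ is $\mathbf{A}^\perp=(A_+,A_-,R)$ where for $x\in A_+$, $y\in A_-$, $x\mathrel{R}y$ holds if and only if $y\mathrel{A}x$ fails. -}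

module Defs where

open import Level using (Level; _⊔_; suc)
open import Data.Nat using (ℕ; _<_)
open import Data.Fin using (Fin)
open import Data.Product using (Σ; ∃; _×_)
open import Relation.Nullary using (¬_)
open import Function.Definitions using (Injective)
open import Relation.Binary.PropositionalEquality using (_≡_)

record BinRel (ℓ : Level) : Set (Level.suc ℓ) where
  field
    Neg : Set ℓ
    Pos : Set ℓ
    Rel : Neg → Pos → Set ℓ
open BinRel public

-- A finite family of k elements of A₊ given by an injective enumeration
-- (so the family has cardinality exactly k); it is A-dominating if every
-- a ∈ A₋ is related to some member.
Dominates : ∀ {ℓ} (A : BinRel ℓ) {k : ℕ} → (Fin k → Pos A) → Set ℓ
Dominates A {k} Y = ∀ (a : Neg A) → ∃ λ (i : Fin k) → Rel A a (Y i)

DominatingNumberIs : ∀ {ℓ} (A : BinRel ℓ) → ℕ → Set ℓ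
DominatingNumberIs A n =
  (Σ (Fin n → Pos A) λ Y → Injective _≡_ _≡_ Y × Dominates A Y)
  × (∀ (k : ℕ) → k < n → (Y : Fin k → Pos A) → Injective _≡_ _≡_ Y → ¬ Dominates A Y)

dual : ∀ {ℓ} → BinRel ℓ → BinRel ℓ
dual A = record { Neg = Pos A ; Pos = Neg A ; Rel = λ x y → ¬ Rel A y x }

-- Write the members of C_n as codes (e, x) with e ∈ Fin n and x a code of length n - 1,
-- and relate (f, x) to (e, y) when f = e, or f is not the cyclic successor of e and x is
-- related to y.  The n codes (e, 0) dominate C_n, and the codes (e + 1, 0) dominate its
-- dual.  Conversely, the first coordinates of fewer than n codes miss a value of Fin n,
-- so some first coordinate e occurs while e + 1 does not.  Choosing the first coordinate
-- e + 1 (respectively e) defeats the member with first coordinate e, and induction on the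
-- length deals with the remaining fewer than n - 1 members through their tails.
module Submission where

open import Defs
open import Level using (0ℓ)
open import Data.Nat using (ℕ; _≥_; _!)
open import Data.Fin using (Fin)
open import Data.Product using (Σ; _×_)
open import Function.Bundles using (_↔_)

open import Data.Empty using (⊥-elim)
open import Data.Unit using (⊤; tt)
open import Data.Sum using (_⊎_; inj₁; inj₂)
open import Data.Product using (∃; _,_; proj₁; proj₂)
open import Data.Product.Function.NonDependent.Propositional using (_×-↔_)
open import Data.Nat using (zero; suc; _≤_; _<_; s≤s; z≤n)
open import Data.Nat.Properties using (1+n≢n; ≤-pred)
open import Data.Fin using (zero; suc; fromℕ; inject₁; toℕ; punchIn; punchOut) renaming (_≤_ to _≤ᶠ_)
open import Data.Fin.Properties
  using (_≟_; any?; ¬∀⟶∃¬; pigeonhole; <⇒≢; punchIn-punchOut; ≤fromℕ; toℕ-inject₁; 1↔⊤; *↔×)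
open import Data.Fin.Relation.Unary.Top using (view; ‵fromℕ; ‵inject₁; view-fromℕ; view-inject₁)
open import Function using (_∘_)
open import Function.Definitions using (Injective)
open import Function.Properties.Inverse using (↔-sym; ↔-trans; ↔-refl)
open import Relation.Nullary using (¬_; yes; no)
open import Relation.Unary using (Pred; Decidable)
open import Relation.Binary.PropositionalEquality using (_≡_; _≢_; refl; sym; trans; cong; subst)

next : ∀ {n} → Fin (suc n) → Fin (suc n)
next i with view i
... | ‵fromℕ     = zero
... | ‵inject₁ j = suc j

next-fromℕ : ∀ n → next (fromℕ n) ≡ zero
next-fromℕ n rewrite view-fromℕ n = refl

next-inject₁ : ∀ {n} (j : Fin n) → next (inject₁ j) ≡ suc j
next-inject₁ j rewrite view-inject₁ j = refl

next-≢ : ∀ {n} (i : Fin (suc (suc n))) → next i ≢ i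
next-≢ i with view i
... | ‵fromℕ     = λ ()
... | ‵inject₁ j = λ eq → 1+n≢n (trans (cong toℕ eq) (toℕ-inject₁ j))

linear-exit : ∀ {p n} (P : Pred (Fin (suc n)) p) → Decidable P → ∀ {a b} →
              a ≤ᶠ b → P a → ¬ P b → ∃ λ (j : Fin n) → P (inject₁ j) × ¬ P (suc j)
linear-exit P P? {zero} {zero} _ pa ¬pb = ⊥-elim (¬pb pa)
linear-exit {n = suc n} P P? {zero} {suc b} _ pa ¬pb with P? (suc zero)
... | no ¬p₁ = zero , pa , ¬p₁
... | yes p₁ with linear-exit (P ∘ suc) (P? ∘ suc) {zero} {b} z≤n p₁ ¬pb
...   | j , pj , ¬pj = suc j , pj , ¬pj
linear-exit {n = suc n} P P? {suc a} {suc b} (s≤s a≤b) pa ¬pb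
  with linear-exit (P ∘ suc) (P? ∘ suc) a≤b pa ¬pb
... | j , pj , ¬pj = suc j , pj , ¬pj

cyclic-exit : ∀ {p n} (P : Pred (Fin (suc n)) p) → Decidable P → ∀ {a b} →
              P a → ¬ P b → ∃ λ i → P i × ¬ P (next i)
cyclic-exit {n = n} P P? {a} {b} pa ¬pb with P? zero | P? (fromℕ n)
... | yes p₀ | _ with linear-exit P P? z≤n p₀ ¬pb
...   | j , pj , ¬pj = inject₁ j , pj , subst (¬_ ∘ P) (sym (next-inject₁ j)) ¬pj
cyclic-exit {n = n} P P? {a} {b} pa ¬pb | no ¬p₀ | yes pₙ =
  fromℕ n , pₙ , subst (¬_ ∘ P) (sym (next-fromℕ n)) ¬p₀
cyclic-exit {n = n} P P? {a} {b} pa ¬pb | no ¬p₀ | no ¬pₙ with linear-exit P P? (≤fromℕ a) pa ¬pₙ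
...   | j , pj , ¬pj = inject₁ j , pj , subst (¬_ ∘ P) (sym (next-inject₁ j)) ¬pj

missing-value : ∀ {k n} → k < n → (f : Fin k → Fin n) → ∃ λ v → ∀ i → f i ≢ v
missing-value {n = n} k<n f with ¬∀⟶∃¬ n (λ v → ∃ λ i → f i ≡ v) (λ v → any? λ i → f i ≟ v) onto⇒⊥
  where
  onto⇒⊥ : ¬ (∀ v → ∃ λ i → f i ≡ v)
  onto⇒⊥ onto with pigeonhole k<n (proj₁ ∘ onto)
  ... | u , w , u<w , eq = <⇒≢ u<w (trans (sym (proj₂ (onto u))) (trans (cong f eq) (proj₂ (onto w))))
... | v , v∉ = v , λ i eq → v∉ (i , eq)

image-exit : ∀ {k n} → k < n → (f : Fin (suc k) → Fin (suc n)) →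
             ∃ λ i₀ → ∀ i → f i ≢ next (f i₀)
image-exit k<n f with missing-value (s≤s k<n) f
... | v , v∉ with cyclic-exit (λ e → ∃ λ i → f i ≡ e) (λ e → any? λ i → f i ≟ e) (zero , refl) (λ (i , eq) → v∉ i eq)
...   | e , (i₀ , refl) , ¬next = i₀ , λ i eq → ¬next (i , eq)

∀-punchIn⇒∀-≢ : ∀ {p n} {P : Pred (Fin (suc n)) p} i →
                (∀ j → P (punchIn i j)) → ∀ j → i ≢ j → P j
∀-punchIn⇒∀-≢ {P = P} i h j i≢j = subst P (punchIn-punchOut i≢j) (h (punchOut i≢j))

-- Code m = Fin (m + 1) × ⋯ × Fin 2 has (m + 1)! elements, and 𝐂 m is the paper's C_(m+1).
Code : ℕ → Set
Code zero    = ⊤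
Code (suc m) = Fin (suc (suc m)) × Code m

Related : ∀ m → Code m → Code m → Set
Related zero    _       _       = ⊤
Related (suc m) (f , x) (e , y) = f ≡ e ⊎ (f ≢ next e × Related m x y)

𝐂 : ℕ → BinRel 0ℓ
𝐂 m = record { Neg = Code m ; Pos = Code m ; Rel = Related m }

origin : ∀ m → Code m
origin zero    = tt
origin (suc m) = zero , origin m

Code↔Fin : ∀ m → Code m ↔ Fin (suc m !)
Code↔Fin zero    = ↔-sym 1↔⊤
Code↔Fin (suc m) = ↔-trans (↔-refl ×-↔ Code↔Fin m) (↔-sym *↔×)

∃-unrelated-to-all : ∀ m {k} → k ≤ m → (Y : Fin k → Code m) →
                     ∃ λ x → ∀ i → ¬ Related m x (Y i)
∃-unrelated-to-all m       {zero}  _   Y = origin m , λ ()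
∃-unrelated-to-all (suc m) {suc k} k<m Y with image-exit k<m (proj₁ ∘ Y)
... | i₀ , escape with ∃-unrelated-to-all m (≤-pred k<m) (proj₂ ∘ Y ∘ punchIn i₀)
...   | x , x-unrelated = (next (proj₁ (Y i₀)) , x) , unrelated
  where
  unrelated : ∀ i → ¬ Related (suc m) (next (proj₁ (Y i₀)) , x) (Y i)
  unrelated i (inj₁ eq) = escape i (sym eq)
  unrelated i (inj₂ (≢next , r)) with i₀ ≟ i
  ... | yes refl = ≢next refl
  ... | no i₀≢i  = ∀-punchIn⇒∀-≢ {P = λ i → ¬ Related m x (proj₂ (Y i))} i₀ x-unrelated i i₀≢i r

∃-related-from-all : ∀ m {k} → k ≤ m → (Y : Fin k → Code m) →
                     ∃ λ y → ∀ i → Related m (Y i) y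
∃-related-from-all m       {zero}  _   Y = origin m , λ ()
∃-related-from-all (suc m) {suc k} k<m Y with image-exit k<m (proj₁ ∘ Y)
... | i₀ , escape with ∃-related-from-all m (≤-pred k<m) (proj₂ ∘ Y ∘ punchIn i₀)
...   | y , y-related = (proj₁ (Y i₀) , y) , related
  where
  related : ∀ i → Related (suc m) (Y i) (proj₁ (Y i₀) , y)
  related i with proj₁ (Y i) ≟ proj₁ (Y i₀) | i₀ ≟ i
  ... | yes eq | _        = inj₁ eq
  ... | no ≢₀  | yes refl = ⊥-elim (≢₀ refl)
  ... | no _   | no i₀≢i  = inj₂ (escape i , ∀-punchIn⇒∀-≢ i₀ y-related i i₀≢i)

first-coordinates : ∀ m → Fin (suc (suc m)) → Code (suc m)
first-coordinates m e = e , origin m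

first-coordinates-injective : ∀ m → Injective _≡_ _≡_ (first-coordinates m)
first-coordinates-injective m = cong proj₁

δ𝐂 : ∀ m → DominatingNumberIs (𝐂 (suc m)) (suc (suc m))
δ𝐂 m = (first-coordinates m , first-coordinates-injective m , λ (f , _) → f , inj₁ refl)
     , λ k k<n Y _ dominates →
         let (x , unrelated) = ∃-unrelated-to-all (suc m) (≤-pred k<n) Y
             (i , r)         = dominates x
         in unrelated i r

δ𝐂⊥ : ∀ m → DominatingNumberIs (dual (𝐂 (suc m))) (suc (suc m))
δ𝐂⊥ m = (first-coordinates m , first-coordinates-injective m , λ (e , _) → next e , next-unrelated e)
      , λ k k<n Y _ dominates →
          let (y , related) = ∃-related-from-all (suc m) (≤-pred k<n) Y
              (i , ¬r)      = dominates y
          in ¬r (related i)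
  where
  next-unrelated : ∀ e {x y} → ¬ Related (suc m) (next e , x) (e , y)
  next-unrelated e (inj₁ eq)          = next-≢ e eq
  next-unrelated e (inj₂ (≢next , _)) = ≢next refl

theorem6p1 : (n : ℕ) → n ≥ 2 →
    Σ (BinRel 0ℓ) λ C →
      (Neg C ↔ Fin (n !)) × (Pos C ↔ Fin (n !))
      × DominatingNumberIs C n × DominatingNumberIs (dual C) n
theorem6p1 (suc zero)    (s≤s ())
theorem6p1 (suc (suc m)) _          = 𝐂 (suc m) , Code↔Fin (suc m) , Code↔Fin (suc m) , δ𝐂 m , δ𝐂⊥ m
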